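{- In each of the two deduction systems DBL and DBL$_\ast$, for every formula $\phi\in\mathcal{L}$ the sequent $\phi\times\phi\vdash\neg\phi,\phi$ is derivable.
   Context: Fix a finite set $\Theta$ of atomic propositions and a distinguished $\theta_1\in\Theta$. The language $\mathcal{L}$ is the smallest set containing $\Theta$ such that $\neg\phi$, $\phi\rightarrow\psi$ and $(\psi|\phi)$ belong to $\mathcal{L}$ whenever $\phi,\psi\in\mathcal{L}$. Abbreviations: $\phi\vee\psi:=\neg\phi\rightarrow\psi$, $\phi\wedge\psi:=\neg(\neg\phi\vee\neg\psi)$, $\phi\leftrightarrow\psi:=(\phi\rightarrow\psi)\wedge(\psi\rightarrow\phi)$, $\psi\times\phi:=(\psi|\phi)\leftrightarrow\psi$, $\top:=\theta_1\rightarrow\theta_1$, $\bot:=\neg\top$. A sequent is a pair of finite (possibly empty) sequences $\Gamma,\Delta$ of formulas of $\mathcal{L}$, written $\Gamma\vdash\Delta$ (the right side lists alternatives: it is not the same as a single disjunction); "$\Gamma,\Delta$" denotes concatenation and $\{\Gamma\}$ the set of entries of $\Gamma$. The systems DBL and DBL$_\ast$ are the smallest sets of sequents $X$ satisfying, for all $\phi,\psi,\eta\in\mathcal{L}$ and finite sequences $\Gamma,\Delta,\Lambda,\Sigma$: (CUT) if $\Gamma\vdash\Delta,\phi$ and $\Lambda,\phi\vdash\Sigma$ are in $X$ then $\Gamma,\Lambda\vdash\Delta,\Sigma$ is in $X$; (STRUCT) if $\{\Gamma\}\subset\{\Lambda\}\cup\{\top\}$, $\{\Delta\}\subset\{\Sigma\}\cup\{\bot\}$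 and $\Gamma\vdash\Delta$ is in $X$ then $\Lambda\vdash\Sigma$ is in $X$; (modus ponens) $\phi,\phi\rightarrow\psi\vdash\psi$; (c1) $\vdash\phi\rightarrow(\psi\rightarrow\phi)$; (c2) $\vdash(\eta\rightarrow(\phi\rightarrow\psi))\rightarrow((\eta\rightarrow\phi)\rightarrow(\eta\rightarrow\psi))$; (c3) $\vdash(\neg\phi\rightarrow\neg\psi)\rightarrow((\neg\phi\rightarrow\psi)\rightarrow\phi)$; (b1) $\phi\rightarrow\psi\vdash\neg\phi,(\psi|\phi)$; (b2) $\vdash(\psi\rightarrow\eta|\phi)\rightarrow((\psi|\phi)\rightarrow(\eta|\phi))$; (b3) $\vdash(\psi|\phi)\rightarrow(\phi\rightarrow\psi)$; (b4) $\vdash\neg(\neg\psi|\phi)\leftrightarrow(\psi|\phi)$. DBL additionally contains (b5) $\psi\times\phi\vdash\phi\times\psi$. DBL$_\ast$ instead additionally contains (b5.weak.A) $\psi\times\neg\phi\vdash\psi\times\phi$ and $\psi\times\phi\vdash\psi\times\neg\phi$, and (b5.weak.B) $\psi\leftrightarrow\eta\vdash(\phi|\psi)\leftrightarrow(\phi|\eta)$. A sequent is derivable if it belongs to the system. -}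

module Defs where

open import Data.Nat using (ℕ; suc)
open import Data.Fin using (Fin; zero)
open import Data.List using (List; []; _∷_; _++_; [_])
open import Data.List.Membership.Propositional using (_∈_)
open import Data.Sum using (_⊎_)
open import Relation.Binary.PropositionalEquality using (_≡_)

-- Atomic propositions: Θ = Fin (suc n), an arbitrary finite nonempty set;
-- the distinguished atom θ₁ is  zero.
module Language (n : ℕ) where

  Θ : Set
  Θ = Fin (suc n)

  θ₁ : Θ
  θ₁ = zero

  infixr 6 _⇒_
  data Form : Set where
    atom : Θ → Form
    ¬'_  : Form → Form
    _⇒_  : Form → Form → Form
    _∣_  : Form → Form → Form

  _∨'_ : Form → Form → Form
  φ ∨' ψ = (¬' φ) ⇒ ψ

  _∧'_ : Form → Form → Form
  φ ∧' ψ = ¬' ((¬' φ) ∨' (¬' ψ))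

  _⇔_ : Form → Form → Form
  φ ⇔ ψ = (φ ⇒ ψ) ∧' (ψ ⇒ φ)

  _⊠_ : Form → Form → Form
  ψ ⊠ φ = (ψ ∣ φ) ⇔ ψ

  ⊤' : Form
  ⊤' = atom θ₁ ⇒ atom θ₁

  ⊥' : Form
  ⊥' = ¬' ⊤'

  Seq : Set
  Seq = List Form

  data System : Set where
    DBL DBL* : System

  infix 4 _⊢[_]_
  data _⊢[_]_ : Seq → System → Seq → Set where
    cut : ∀ {S Γ Δ Λ Σ φ} →
          Γ ⊢[ S ] (Δ ++ [ φ ]) → (Λ ++ [ φ ]) ⊢[ S ] Σ →
          (Γ ++ Λ) ⊢[ S ] (Δ ++ Σ)
    struct : ∀ {S Γ Δ Λ Σ} →
          (∀ {χ} → χ ∈ Γ → χ ∈ Λ ⊎ χ ≡ ⊤') →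
          (∀ {χ} → χ ∈ Δ → χ ∈ Σ ⊎ χ ≡ ⊥') →
          Γ ⊢[ S ] Δ → Λ ⊢[ S ] Σ
    mp : ∀ {S} φ ψ → (φ ∷ (φ ⇒ ψ) ∷ []) ⊢[ S ] [ ψ ]
    c1 : ∀ {S} φ ψ → [] ⊢[ S ] [ φ ⇒ (ψ ⇒ φ) ]
    c2 : ∀ {S} φ ψ η →
         [] ⊢[ S ] [ (η ⇒ (φ ⇒ ψ)) ⇒ ((η ⇒ φ) ⇒ (η ⇒ ψ)) ]
    c3 : ∀ {S} φ ψ →
         [] ⊢[ S ] [ ((¬' φ) ⇒ (¬' ψ)) ⇒ (((¬' φ) ⇒ ψ) ⇒ φ) ]
    b1 : ∀ {S} φ ψ → [ φ ⇒ ψ ] ⊢[ S ] ((¬' φ) ∷ (ψ ∣ φ) ∷ [])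
    b2 : ∀ {S} φ ψ η →
         [] ⊢[ S ] [ ((ψ ⇒ η) ∣ φ) ⇒ ((ψ ∣ φ) ⇒ (η ∣ φ)) ]
    b3 : ∀ {S} φ ψ → [] ⊢[ S ] [ (ψ ∣ φ) ⇒ (φ ⇒ ψ) ]
    b4 : ∀ {S} φ ψ → [] ⊢[ S ] [ (¬' ((¬' ψ) ∣ φ)) ⇔ (ψ ∣ φ) ]
    b5 : ∀ φ ψ → [ ψ ⊠ φ ] ⊢[ DBL ] [ φ ⊠ ψ ]
    b5wA₁ : ∀ φ ψ → [ ψ ⊠ (¬' φ) ] ⊢[ DBL* ] [ ψ ⊠ φ ]
    b5wA₂ : ∀ φ ψ → [ ψ ⊠ φ ] ⊢[ DBL* ] [ ψ ⊠ (¬' φ) ]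
    b5wB : ∀ φ ψ η → [ ψ ⇔ η ] ⊢[ DBL* ] [ (φ ∣ ψ) ⇔ (φ ∣ η) ]

{-# OPTIONS --safe #-}
module Submission where

-- Rule (b1) applied to ⊢ φ → φ gives ⊢ ¬φ, (φ|φ); and φ × φ has
-- (φ|φ) → φ as its left conjunct, so φ × φ, (φ|φ) ⊢ φ. Cutting on (φ|φ)
-- yields φ × φ ⊢ ¬φ, φ.

open import Defs
open import Data.Nat using (ℕ)
open import Data.List using (List; []; _∷_; _++_; [_])
open import Data.List.Membership.Propositional using (_∈_)
open import Data.List.Relation.Unary.Any using (here; there)
open import Relation.Binary.PropositionalEquality using (refl)

module Derived (n : ℕ) (S : Language.System n) where
  open Language n

  ⊢_ : Form → Set
  ⊢ A = [] ⊢[ S ] [ A ]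

  ⇒-to-sequent : ∀ {Γ A B} → Γ ⊢[ S ] [ A ⇒ B ] → Γ ++ [ A ] ⊢[ S ] [ B ]
  ⇒-to-sequent {A = A} {B} p = cut {Δ = []} {Λ = [ A ]} p (mp A B)

  discharge : ∀ {A Δ} → ⊢ A → [ A ] ⊢[ S ] Δ → [] ⊢[ S ] Δ
  discharge = cut {Γ = []} {Δ = []} {Λ = []}

  modus-ponens : ∀ {A B} → ⊢ A → ⊢ (A ⇒ B) → ⊢ B
  modus-ponens a ab = discharge a (⇒-to-sequent ab)

  ⇒-refl : ∀ A → ⊢ (A ⇒ A)
  ⇒-refl A = modus-ponens (c1 A A) (modus-ponens (c1 A (A ⇒ A)) (c2 (A ⇒ A) A A))

  infix  4 _⊩_
  infixl 5 _·_

  data _⊩_ (Γ : List Form) : Form → Set where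
    hyp : ∀ {A} → A ∈ Γ → Γ ⊩ A
    thm : ∀ {A} → ⊢ A → Γ ⊩ A
    _·_ : ∀ {A B} → Γ ⊩ (A ⇒ B) → Γ ⊩ A → Γ ⊩ B

  ⇒-weaken : ∀ {Γ A B} → Γ ⊩ B → Γ ⊩ (A ⇒ B)
  ⇒-weaken {A = A} {B} p = thm (c1 B A) · p

  deduction : ∀ {Γ A B} → A ∷ Γ ⊩ B → Γ ⊩ (A ⇒ B)
  deduction {A = A} (hyp (here refl)) = thm (⇒-refl A)
  deduction         (hyp (there A∈Γ)) = ⇒-weaken (hyp A∈Γ)
  deduction         (thm t)           = ⇒-weaken (thm t)
  deduction {A = A} (_·_ {C} {B} p q) = thm (c2 C B A) · deduction p · deduction q

  closed : ∀ {A} → [] ⊩ A → ⊢ A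
  closed (hyp ())
  closed (thm t) = t
  closed (p · q) = modus-ponens (closed q) (closed p)

  explosion : ∀ A B → ⊢ (A ⇒ (¬' A ⇒ B))
  explosion A B = closed (deduction (deduction
    (thm (c3 B A) · ⇒-weaken (hyp (here refl)) · ⇒-weaken (hyp (there (here refl))))))

  ∧-elimˡ : ∀ P Q → ⊢ ((P ∧' Q) ⇒ P)
  ∧-elimˡ P Q = closed (deduction
    (thm (c3 P (¬' (¬' P) ⇒ ¬' Q)) · ⇒-weaken (hyp (here refl)) · thm (explosion (¬' P) (¬' Q))))

  ⊠-elim : ∀ ψ φ → (ψ ⊠ φ) ∷ (ψ ∣ φ) ∷ [] ⊢[ S ] [ ψ ]
  ⊠-elim ψ φ = ⇒-to-sequent (⇒-to-sequent (∧-elimˡ ((ψ ∣ φ) ⇒ ψ) (ψ ⇒ (ψ ∣ φ))))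

  ∣-refl : ∀ φ → [] ⊢[ S ] (¬' φ) ∷ (φ ∣ φ) ∷ []
  ∣-refl φ = discharge (⇒-refl φ) (b1 φ φ)

mainTheorem6 : (n : ℕ) → let open Language n in
    (S : System) (φ : Form) →
    (φ ⊠ φ) ∷ [] ⊢[ S ] ((¬' φ) ∷ φ ∷ [])
mainTheorem6 n S φ = cut {Γ = []} {Δ = [ ¬' φ ]} (∣-refl φ) (⊠-elim φ φ)
  where
  open Language n
  open Derived n S
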